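{- Let $w$ be a string of length $n$ over $\Sigma$ and let $r=(i,j,p)$ be any run of $w$. Then for the unique $\ell\in\{0,1\}$ such that $w_\ell[j+1]\prec_\ell w_\ell[j+1-p]$, every L-root of $r$ with respect to $\prec_\ell$ is a right node of $\mathit{LTree}_\ell(w)$.
   Context: $\Sigma$ is a finite alphabet with at least two letters; $\prec_0$ is a total order on $\Sigma$ and $\prec_1$ its reverse. Let $\$,\#_0,\#_1\notin\Sigma$ be distinct extra symbols with $\#_0\prec_0\$\prec_0 a$ and $\#_1\prec_1 a\prec_1\$$ for all $a\in\Sigma$. Each $\prec_\ell$ also denotes the induced lexicographic order on strings (proper prefix smaller). Define $w_\ell=\#_\ell w\$$, indexed from $0$ so that $w_\ell[0]=\#_\ell$, $w_\ell[k]=w[k]$ for $1\le k\le n$, $w_\ell[n+1]=\$$; $w_\ell$ is a Lyndon word w.r.t. $\prec_\ell$. A nonempty string $u$ is Lyndon w.r.t. $\prec_\ell$ if $u\prec_\ell v$ for every nonempty proper suffix $v$. A period of $s$ is $p\ge1$ with $s[m]=s[m+p]$ for all valid $m$. A run of $w$ is a triple $(i,j,p)$, $1\le i\le j\le n$, with $p$ the smallest period of $w[i..j]$, $j-i+1\ge2p$, ($i=1$ or $w[i-1]\ne w[i+p-1]$), and ($j=n$ or $w[j+1]\ne w[j-p+1]$). An L-root of run $(i,j,p)$ w.r.t. $\prec_\ell$ is an interval $[a..b]$ of length $p$ with $i\le a\le b\le j$ such that $w[a..b]$ is Lyndon w.r.t. $\prec_\ell$. The standard factorization of a Lyndon word $u$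 ($|u|\ge2$) w.r.t. $\prec_\ell$ is $u=xy$ with $y$ the $\prec_\ell$-smallest nonempty proper suffix. $\mathit{LTree}_\ell(w)$ is the Lyndon tree of $w_\ell$ w.r.t. $\prec_\ell$: a single node if length 1, otherwise root with left child the tree of $x$ and right child the tree of $y$ for the standard factorization $(x,y)$; nodes are identified with the intervals of positions of $w_\ell$ they span. A right node is a node that is the right child of its parent. -}

module Defs where

open import Level using (0ℓ)
open import Data.Nat using (ℕ; zero; suc; _+_; _*_; _∸_; _≤_; _<_)
open import Data.Fin using (Fin)
open import Data.List using (List; []; _∷_; _++_; map; length; take; drop)
open import Data.Maybe using (Maybe; just; nothing)
open import Data.Product using (Σ; ∃; _×_)
open import Data.Sum using (_⊎_)
open import Relation.Binary.Core using (Rel)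
open import Relation.Binary.PropositionalEquality using (_≡_; _≢_)

at : ∀ {A : Set} → List A → ℕ → Maybe A
at []       _       = nothing
at (x ∷ xs) zero    = just x
at (x ∷ xs) (suc k) = at xs k

-- 0-indexed interval s[a..b] (inclusive)
sub : ∀ {A : Set} → List A → ℕ → ℕ → List A
sub s a b = take (suc b ∸ a) (drop a s)

-- 1-indexed access w[k] and interval w[i..j] of the input string w
wAt : ∀ {A : Set} → List A → ℕ → Maybe A
wAt w k = at w (k ∸ 1)

wSub : ∀ {A : Set} → List A → ℕ → ℕ → List A
wSub w i j = take (suc j ∸ i) (drop (i ∸ 1) w)

Period : ∀ {A : Set} → List A → ℕ → Set
Period s p = 1 ≤ p × (∀ m → m + p < length s → at s m ≡ at s (m + p))

SmallestPeriod : ∀ {A : Set} → List A → ℕ → Set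
SmallestPeriod s p = Period s p × (∀ q → Period s q → p ≤ q)

-- runs of w (1-indexed positions, n = length w)
IsRun : ∀ {A : Set} → List A → ℕ → ℕ → ℕ → Set
IsRun w i j p =
  1 ≤ i × i ≤ j × j ≤ length w
  × SmallestPeriod (wSub w i j) p
  × 2 * p ≤ suc j ∸ i
  × (i ≡ 1 ⊎ wAt w (i ∸ 1) ≢ wAt w (i + p ∸ 1))
  × (j ≡ length w ⊎ wAt w (suc j) ≢ wAt w (suc j ∸ p))

-- extended alphabet: hash stands for #_ℓ, dollar for $
data Ext (m : ℕ) : Set where
  hash   : Ext m
  dollar : Ext m
  ch     : Fin m → Ext m

wℓ : ∀ {m} → List (Fin m) → List (Ext m)
wℓ w = hash ∷ (map ch w ++ (dollar ∷ []))

module Ord {m : ℕ} (_≺_ : Rel (Fin m) 0ℓ) where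

  data ExtLt : Fin 2 → Ext m → Ext m → Set where
    h<d₀ : ExtLt Fin.zero hash dollar
    h<c₀ : ∀ {a} → ExtLt Fin.zero hash (ch a)
    d<c₀ : ∀ {a} → ExtLt Fin.zero dollar (ch a)
    c<c₀ : ∀ {a b} → a ≺ b → ExtLt Fin.zero (ch a) (ch b)
    h<d₁ : ExtLt (Fin.suc Fin.zero) hash dollar
    h<c₁ : ∀ {a} → ExtLt (Fin.suc Fin.zero) hash (ch a)
    c<d₁ : ∀ {a} → ExtLt (Fin.suc Fin.zero) (ch a) dollar
    c<c₁ : ∀ {a b} → b ≺ a → ExtLt (Fin.suc Fin.zero) (ch a) (ch b)

  data Lex (ℓ : Fin 2) : List (Ext m) → List (Ext m) → Set where
    nil   : ∀ {y ys} → Lex ℓ [] (y ∷ ys)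
    here  : ∀ {x y xs ys} → ExtLt ℓ x y → Lex ℓ (x ∷ xs) (y ∷ ys)
    there : ∀ {x xs ys} → Lex ℓ xs ys → Lex ℓ (x ∷ xs) (x ∷ ys)

  LexLe : Fin 2 → List (Ext m) → List (Ext m) → Set
  LexLe ℓ u v = Lex ℓ u v ⊎ u ≡ v

  Lyndon : Fin 2 → List (Ext m) → Set
  Lyndon ℓ u = 1 ≤ length u × (∀ k → 1 ≤ k → k < length u → Lex ℓ u (drop k u))

  StdFact : Fin 2 → List (Ext m) → ℕ → ℕ → ℕ → Set
  StdFact ℓ s a k b =
    a < k × k ≤ b × (∀ k' → a < k' → k' ≤ b → LexLe ℓ (sub s k b) (sub s k' b))

  -- nodes of the Lyndon tree of s (as intervals [a..b] of positions of s)
  data Node (ℓ : Fin 2) (s : List (Ext m)) : ℕ → ℕ → Set where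
    root  : Node ℓ s 0 (length s ∸ 1)
    left  : ∀ {a k b} → Node ℓ s a b → StdFact ℓ s a k b → Node ℓ s a (k ∸ 1)
    right : ∀ {a k b} → Node ℓ s a b → StdFact ℓ s a k b → Node ℓ s k b

  RightNode : Fin 2 → List (Ext m) → ℕ → ℕ → Set
  RightNode ℓ s k b = ∃ λ a → Node ℓ s a b × StdFact ℓ s a k b

  RightNodeOfLTree : Fin 2 → List (Fin m) → ℕ → ℕ → Set
  RightNodeOfLTree ℓ w a b = RightNode ℓ (wℓ w) a b

  -- L-root [a..b] of run (i,j,p) w.r.t. ≺_ℓ  (w[a..b] = w_ℓ[a..b] for 1 ≤ a ≤ b ≤ n)
  LRoot : Fin 2 → List (Fin m) → ℕ → ℕ → ℕ → ℕ → ℕ → Set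
  LRoot ℓ w i j p a b =
    suc b ∸ a ≡ p × i ≤ a × a ≤ b × b ≤ j × Lyndon ℓ (map ch (wSub w a b))

  LtAt : Fin 2 → List (Fin m) → ℕ → ℕ → Set
  LtAt ℓ w x y = ∃ λ c → ∃ λ d →
    at (wℓ w) x ≡ just c × at (wℓ w) y ≡ just d × ExtLt ℓ c d

-- Descend the Lyndon tree of w_ℓ from the root, keeping a node [x..y] with x < a ≤ b ≤ y, and
-- look at the cut k of its standard factorization (the start of its minimal proper suffix).
-- A cut a < k ≤ b is impossible: since w[a..b] is Lyndon, w_ℓ[a..y] ≺ w_ℓ[k..y].  A cut k = a
-- with b < y is impossible too: by periodicity w_ℓ[b+1..y] agrees with w_ℓ[a..y] until it ends
-- or meets w_ℓ[j+1] ≺ w_ℓ[j+1-p], so w_ℓ[b+1..y] ≺ w_ℓ[a..y].  Hence the descent goes right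
-- while k < a, left while k > b, and stops at a node cut at a that ends at b.
module Submission where

open import Defs
open import Level using (0ℓ)
open import Data.Nat using (ℕ; zero; suc; _+_; _∸_; _≤_; _<_; s≤s; z<s; _≤?_)
open import Data.Nat.Properties
open import Data.Fin using (Fin)
open import Data.List using (List; []; _∷_; _++_; map; length; take; drop; applyUpTo)
open import Data.List.Properties using (length-map; length-++-≤ˡ; length-take; length-drop; take-map; drop-map)
open import Data.List.Relation.Unary.All using (lookup; tabulate)
open import Data.List.Membership.Propositional using (_∈_)
open import Data.List.Membership.Propositional.Properties using (∈-applyUpTo⁺; ∈-applyUpTo⁻)
import Data.List.Extrema as Extrema
open import Data.Maybe as Maybe using (Maybe; just)
open import Data.Product using (∃; _×_; _,_; proj₁; proj₂)
open import Data.Sum using (_⊎_; inj₁; inj₂)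
open import Data.Empty using (⊥-elim)
open import Function using (_∘_)
open import Relation.Binary.Core using (Rel)
open import Relation.Binary.Bundles using (TotalOrder)
open import Relation.Binary.Definitions using (Irreflexive; Transitive; Trichotomous; tri<; tri≈; tri>)
open import Relation.Binary.PropositionalEquality
open import Relation.Binary.Structures using (IsStrictTotalOrder)
open import Relation.Binary.Structures.Biased using (isStrictTotalOrderᶜ)
import Relation.Binary.Construct.StrictToNonStrict as StrictToNonStrict
open import Relation.Nullary using (¬_; Dec; yes; no)

m+n≤o⇒n<1+o∸m : ∀ m {n o} → m + n ≤ o → n < suc o ∸ m
m+n≤o⇒n<1+o∸m zero    n≤o       = s≤s n≤o
m+n≤o⇒n<1+o∸m (suc m) (s≤s m+n≤o) = m+n≤o⇒n<1+o∸m m m+n≤o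

n<1+o∸m⇒m+n≤o : ∀ m {n o} → n < suc o ∸ m → m + n ≤ o
n<1+o∸m⇒m+n≤o zero    n<1+o = ≤-pred n<1+o
n<1+o∸m⇒m+n≤o (suc m) {o = suc o} n<1+o∸m = s≤s (n<1+o∸m⇒m+n≤o m n<1+o∸m)
n<1+o∸m⇒m+n≤o (suc zero)    {o = zero} ()
n<1+o∸m⇒m+n≤o (suc (suc m)) {o = zero} ()

module _ {A : Set} where

  at-drop : ∀ t (xs : List A) r → at (drop t xs) r ≡ at xs (t + r)
  at-drop zero    xs       r = refl
  at-drop (suc t) []       r = refl
  at-drop (suc t) (x ∷ xs) r = at-drop t xs r

  at-take : ∀ L (xs : List A) {r} → r < L → at (take L xs) r ≡ at xs r
  at-take (suc L) []       _         = refl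
  at-take (suc L) (x ∷ xs) {zero}  _         = refl
  at-take (suc L) (x ∷ xs) {suc r} (s≤s r<L) = at-take L xs r<L

  at-just⇒< : ∀ (xs : List A) q {x} → at xs q ≡ just x → q < length xs
  at-just⇒< (x ∷ xs) zero    _  = z<s
  at-just⇒< (x ∷ xs) (suc q) eq = s≤s (at-just⇒< xs q eq)

  at-sub : ∀ (s : List A) u {y r} → u + r ≤ y → at (sub s u y) r ≡ at s (u + r)
  at-sub s u {r = r} u+r≤y = trans (at-take _ (drop u s) (m+n≤o⇒n<1+o∸m u u+r≤y)) (at-drop u s r)

  length-sub : ∀ (s : List A) u {y} → y < length s → length (sub s u y) ≡ suc y ∸ u
  length-sub s u y<∣s∣ = trans (length-take _ (drop u s))
    (m≤n⇒m⊓n≡m (subst (_ ≤_) (sym (length-drop u s)) (∸-monoˡ-≤ u y<∣s∣)))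

  take-++ˡ : ∀ L (xs ys : List A) → L ≤ length xs → take L (xs ++ ys) ≡ take L xs
  take-++ˡ zero    xs       ys _           = refl
  take-++ˡ (suc L) (x ∷ xs) ys (s≤s L≤∣xs∣) = cong (x ∷_) (take-++ˡ L xs ys L≤∣xs∣)

  take-drop-++ˡ : ∀ d L (xs ys : List A) → L ≤ length xs ∸ d → take L (drop d (xs ++ ys)) ≡ take L (drop d xs)
  take-drop-++ˡ zero    L    xs       ys L≤∣xs∣   = take-++ˡ L xs ys L≤∣xs∣
  take-drop-++ˡ (suc d) zero []       ys _        = refl
  take-drop-++ˡ (suc d) L    (x ∷ xs) ys L≤∣xs∣∸d = take-drop-++ˡ d L xs ys L≤∣xs∣∸d

at-map : ∀ {A B : Set} (f : A → B) xs r → at (map f xs) r ≡ Maybe.map f (at xs r)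
at-map f []       r       = refl
at-map f (x ∷ xs) zero    = refl
at-map f (x ∷ xs) (suc r) = at-map f xs r

Period-map : ∀ {A B : Set} (f : A → B) {xs p} → Period xs p → Period (map f xs) p
Period-map f {xs} {p} (1≤p , period) = 1≤p , λ r r+p<∣fxs∣ → begin
  at (map f xs) r             ≡⟨ at-map f xs r ⟩
  Maybe.map f (at xs r)       ≡⟨ cong (Maybe.map f) (period r (subst (r + p <_) (length-map f xs) r+p<∣fxs∣)) ⟩
  Maybe.map f (at xs (r + p)) ≡⟨ sym (at-map f xs (r + p)) ⟩
  at (map f xs) (r + p)       ∎
  where open ≡-Reasoning

module _ {A : Set} {_<_ : Rel A 0ℓ} (irrefl : Irreflexive _≡_ _<_) (trans< : Transitive _<_) where

  trichotomous : (∀ x y → x < y ⊎ x ≡ y ⊎ y < x) → Trichotomous _≡_ _<_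
  trichotomous cmp x y with cmp x y
  ... | inj₁ x<y        = tri< x<y (λ x≡y → irrefl x≡y x<y) (λ y<x → irrefl refl (trans< x<y y<x))
  ... | inj₂ (inj₁ x≡y) = tri≈ (irrefl x≡y) x≡y (irrefl (sym x≡y))
  ... | inj₂ (inj₂ y<x) = tri> (λ x<y → irrefl refl (trans< x<y y<x)) (λ x≡y → irrefl (sym x≡y) y<x) y<x

module LyndonTree {m : ℕ} {_≺_ : Rel (Fin m) 0ℓ} (≺-isStrictTotalOrder : IsStrictTotalOrder _≡_ _≺_) where
  open Ord _≺_
  open IsStrictTotalOrder ≺-isStrictTotalOrder using () renaming (compare to ≺-compare; trans to ≺-trans; irrefl to ≺-irrefl)

  ExtLt-irrefl : ∀ {ℓ} → Irreflexive _≡_ (ExtLt ℓ)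
  ExtLt-irrefl refl (c<c₀ a≺a) = ≺-irrefl refl a≺a
  ExtLt-irrefl refl (c<c₁ a≺a) = ≺-irrefl refl a≺a

  ExtLt-trans : ∀ {ℓ} → Transitive (ExtLt ℓ)
  ExtLt-trans h<d₀     d<c₀     = h<c₀
  ExtLt-trans h<c₀     (c<c₀ _) = h<c₀
  ExtLt-trans d<c₀     (c<c₀ _) = d<c₀
  ExtLt-trans (c<c₀ p) (c<c₀ q) = c<c₀ (≺-trans p q)
  ExtLt-trans h<c₁     c<d₁     = h<d₁
  ExtLt-trans h<c₁     (c<c₁ _) = h<c₁
  ExtLt-trans (c<c₁ _) c<d₁     = c<d₁
  ExtLt-trans (c<c₁ p) (c<c₁ q) = c<c₁ (≺-trans q p)

  ExtLt-compare : ∀ ℓ → Trichotomous _≡_ (ExtLt ℓ)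
  ExtLt-compare ℓ = trichotomous ExtLt-irrefl ExtLt-trans (cmp ℓ)
    where
    cmp : ∀ ℓ (x y : Ext m) → ExtLt ℓ x y ⊎ x ≡ y ⊎ ExtLt ℓ y x
    cmp Fin.zero           hash   hash   = inj₂ (inj₁ refl)
    cmp Fin.zero           hash   dollar = inj₁ h<d₀
    cmp Fin.zero           hash   (ch _) = inj₁ h<c₀
    cmp Fin.zero           dollar hash   = inj₂ (inj₂ h<d₀)
    cmp Fin.zero           dollar dollar = inj₂ (inj₁ refl)
    cmp Fin.zero           dollar (ch _) = inj₁ d<c₀
    cmp Fin.zero           (ch _) hash   = inj₂ (inj₂ h<c₀)
    cmp Fin.zero           (ch _) dollar = inj₂ (inj₂ d<c₀)
    cmp (Fin.suc Fin.zero) hash   hash   = inj₂ (inj₁ refl)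
    cmp (Fin.suc Fin.zero) hash   dollar = inj₁ h<d₁
    cmp (Fin.suc Fin.zero) hash   (ch _) = inj₁ h<c₁
    cmp (Fin.suc Fin.zero) dollar hash   = inj₂ (inj₂ h<d₁)
    cmp (Fin.suc Fin.zero) dollar dollar = inj₂ (inj₁ refl)
    cmp (Fin.suc Fin.zero) dollar (ch _) = inj₂ (inj₂ c<d₁)
    cmp (Fin.suc Fin.zero) (ch _) hash   = inj₂ (inj₂ h<c₁)
    cmp (Fin.suc Fin.zero) (ch _) dollar = inj₁ c<d₁
    cmp Fin.zero           (ch a) (ch b) with ≺-compare a b
    ... | tri< a≺b _ _  = inj₁ (c<c₀ a≺b)
    ... | tri≈ _ refl _ = inj₂ (inj₁ refl)
    ... | tri> _ _ b≺a  = inj₂ (inj₂ (c<c₀ b≺a))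
    cmp (Fin.suc Fin.zero) (ch a) (ch b) with ≺-compare a b
    ... | tri< a≺b _ _  = inj₂ (inj₂ (c<c₁ a≺b))
    ... | tri≈ _ refl _ = inj₂ (inj₁ refl)
    ... | tri> _ _ b≺a  = inj₁ (c<c₁ b≺a)

  Lex-irrefl : ∀ {ℓ} → Irreflexive _≡_ (Lex ℓ)
  Lex-irrefl refl (here x<x)  = ExtLt-irrefl refl x<x
  Lex-irrefl refl (there u<u) = Lex-irrefl refl u<u

  Lex-trans : ∀ {ℓ} → Transitive (Lex ℓ)
  Lex-trans nil       (here _)  = nil
  Lex-trans nil       (there _) = nil
  Lex-trans (here e)  (here f)  = here (ExtLt-trans e f)
  Lex-trans (here e)  (there _) = here e
  Lex-trans (there _) (here f)  = here f
  Lex-trans (there l) (there k) = there (Lex-trans l k)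

  Lex-compare : ∀ ℓ → Trichotomous _≡_ (Lex ℓ)
  Lex-compare ℓ = trichotomous Lex-irrefl Lex-trans cmp
    where
    cmp : ∀ u v → Lex ℓ u v ⊎ u ≡ v ⊎ Lex ℓ v u
    cmp []      []      = inj₂ (inj₁ refl)
    cmp []      (_ ∷ _) = inj₁ nil
    cmp (_ ∷ _) []      = inj₂ (inj₂ nil)
    cmp (x ∷ u) (y ∷ v) with ExtLt-compare ℓ x y | cmp u v
    ... | tri< x<y _ _  | _                = inj₁ (here x<y)
    ... | tri> _ _ y<x  | _                = inj₂ (inj₂ (here y<x))
    ... | tri≈ _ refl _ | inj₁ u<v         = inj₁ (there u<v)
    ... | tri≈ _ refl _ | inj₂ (inj₁ refl) = inj₂ (inj₁ refl)
    ... | tri≈ _ refl _ | inj₂ (inj₂ v<u)  = inj₂ (inj₂ (there v<u))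

  Lex-isStrictTotalOrder : ∀ ℓ → IsStrictTotalOrder _≡_ (Lex ℓ)
  Lex-isStrictTotalOrder ℓ = isStrictTotalOrderᶜ record
    { isEquivalence = isEquivalence ; trans = Lex-trans ; compare = Lex-compare ℓ }

  LexLe-totalOrder : Fin 2 → TotalOrder 0ℓ 0ℓ 0ℓ
  LexLe-totalOrder ℓ = record
    { isTotalOrder = StrictToNonStrict.isTotalOrder _≡_ (Lex ℓ) (Lex-isStrictTotalOrder ℓ) }

  JustLt : Fin 2 → Maybe (Ext m) → Maybe (Ext m) → Set
  JustLt ℓ mx my = ∃ λ c → ∃ λ d → mx ≡ just c × my ≡ just d × ExtLt ℓ c d

  Mismatch : Fin 2 → (ℕ → Maybe (Ext m)) → (ℕ → Maybe (Ext m)) → ℕ → Set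
  Mismatch ℓ f g q = (∀ r → r < q → f r ≡ g r) × JustLt ℓ (f q) (g q)

  Mismatch-cong : ∀ {ℓ f f′ g g′ q} → (∀ r → r ≤ q → f r ≡ f′ r) → (∀ r → r ≤ q → g r ≡ g′ r) →
                  Mismatch ℓ f g q → Mismatch ℓ f′ g′ q
  Mismatch-cong f≡f′ g≡g′ (agree , c , d , fq , gq , c<d) =
    (λ r r<q → trans (sym (f≡f′ r (<⇒≤ r<q))) (trans (agree r r<q) (g≡g′ r (<⇒≤ r<q)))) ,
    c , d , trans (sym (f≡f′ _ ≤-refl)) fq , trans (sym (g≡g′ _ ≤-refl)) gq , c<d

  Lex-fromMismatch : ∀ {ℓ} xs ys q → Mismatch ℓ (at xs) (at ys) q → Lex ℓ xs ys
  Lex-fromMismatch []       _        _       (_ , _ , _ , () , _)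
  Lex-fromMismatch (_ ∷ _)  []       _       (_ , _ , _ , _ , () , _)
  Lex-fromMismatch (x ∷ xs) (y ∷ ys) zero    (_ , _ , _ , refl , refl , x<y) = here x<y
  Lex-fromMismatch (x ∷ xs) (y ∷ ys) (suc q) (agree , mismatch) with agree 0 z<s
  ... | refl = there (Lex-fromMismatch xs ys q ((λ r r<q → agree (suc r) (s≤s r<q)) , mismatch))

  Lex-toMismatch : ∀ {ℓ xs ys} → Lex ℓ xs ys → length ys ≤ length xs → ∃ (Mismatch ℓ (at xs) (at ys))
  Lex-toMismatch (here {x} {y} x<y) _ = 0 , (λ _ ()) , x , y , refl , refl , x<y
  Lex-toMismatch (there xs<ys) (s≤s ∣ys∣≤∣xs∣) with Lex-toMismatch xs<ys ∣ys∣≤∣xs∣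
  ... | q , agree , mismatch = suc q , (λ { zero _ → refl ; (suc r) (s≤s r<q) → agree r r<q }) , mismatch

  Lex-fromPrefix : ∀ {ℓ} xs ys → (∀ r → r < length xs → at xs r ≡ at ys r) → length xs < length ys → Lex ℓ xs ys
  Lex-fromPrefix []       (_ ∷ _)  _     _                = nil
  Lex-fromPrefix (x ∷ xs) (y ∷ ys) agree (s≤s ∣xs∣<∣ys∣) with agree 0 z<s
  ... | refl = there (Lex-fromPrefix xs ys (λ r r<∣xs∣ → agree (suc r) (s≤s r<∣xs∣)) ∣xs∣<∣ys∣)

  module _ {ℓ : Fin 2} (s : List (Ext m)) where

    sub-Lex-mismatch : ∀ u v q {y₁ y₂} → u + q ≤ y₁ → v + q ≤ y₂ →
      Mismatch ℓ (λ r → at s (u + r)) (λ r → at s (v + r)) q → Lex ℓ (sub s u y₁) (sub s v y₂)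
    sub-Lex-mismatch u v q u+q≤y₁ v+q≤y₂ = Lex-fromMismatch _ _ q ∘ Mismatch-cong
      (λ r r≤q → sym (at-sub s u (≤-trans (+-monoʳ-≤ u r≤q) u+q≤y₁)))
      (λ r r≤q → sym (at-sub s v (≤-trans (+-monoʳ-≤ v r≤q) v+q≤y₂)))

    sub-Lex-prefix : ∀ {u v y} → v < u → u ≤ y → y < length s →
      (∀ r → u + r ≤ y → at s (u + r) ≡ at s (v + r)) → Lex ℓ (sub s u y) (sub s v y)
    sub-Lex-prefix {u} {v} {y} v<u u≤y y<∣s∣ agree = Lex-fromPrefix _ _ agree′
      (subst₂ _<_ (sym (length-sub s u y<∣s∣)) (sym (length-sub s v y<∣s∣))
        (∸-monoʳ-< v<u (m≤n⇒m≤1+n u≤y)))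
      where
      agree′ : ∀ r → r < length (sub s u y) → at (sub s u y) r ≡ at (sub s v y) r
      agree′ r r<∣sub∣ = begin
        at (sub s u y) r ≡⟨ at-sub s u u+r≤y ⟩
        at s (u + r)     ≡⟨ agree r u+r≤y ⟩
        at s (v + r)     ≡⟨ sym (at-sub s v (≤-trans (+-monoˡ-≤ r (<⇒≤ v<u)) u+r≤y)) ⟩
        at (sub s v y) r ∎
        where
        open ≡-Reasoning
        u+r≤y : u + r ≤ y
        u+r≤y = n<1+o∸m⇒m+n≤o u (subst (r <_) (length-sub s u y<∣s∣) r<∣sub∣)

    stdFact-exists : ∀ {x y} → x < y → ∃ λ k → StdFact ℓ s x k y
    stdFact-exists {x} {y} x<y =
      k , proj₁ k-range , proj₂ k-range ,
      λ k′ x<k′ k′≤y → lookup (f[argmin]≤f[xs] y cuts) (cut∈ x<k′ k′≤y)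
      where
      open Extrema (LexLe-totalOrder ℓ) using (argmin; argmin-all; f[argmin]≤f[xs])
      suffix : ℕ → List (Ext m)
      suffix k = sub s k y
      cuts : List ℕ
      cuts = applyUpTo (suc x +_) (y ∸ x)
      k : ℕ
      k = argmin suffix y cuts
      cut-range : ∀ {k′} → k′ ∈ cuts → x < k′ × k′ ≤ y
      cut-range k′∈ with ∈-applyUpTo⁻ (suc x +_) k′∈
      ... | i , i<y∸x , refl = s≤s (m≤m+n x i) , n<1+o∸m⇒m+n≤o (suc x) i<y∸x
      k-range : x < k × k ≤ y
      k-range = argmin-all suffix (x<y , ≤-refl) (tabulate cut-range)
      cut∈ : ∀ {k′} → x < k′ → k′ ≤ y → k′ ∈ cuts
      cut∈ x<k′ k′≤y with m≤n⇒∃[o]m+o≡n x<k′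
      ... | i , refl = ∈-applyUpTo⁺ (suc x +_) (m+n≤o⇒n<1+o∸m (suc x) k′≤y)

    stdFact-minimal : ∀ {x k y k′} → StdFact ℓ s x k y → x < k′ → k′ ≤ y → ¬ Lex ℓ (sub s k′ y) (sub s k y)
    stdFact-minimal (_ , _ , minimal) x<k′ k′≤y k′<k with minimal _ x<k′ k′≤y
    ... | inj₁ k<k′ = Lex-irrefl refl (Lex-trans k<k′ k′<k)
    ... | inj₂ k≡k′ = Lex-irrefl (sym k≡k′) k′<k

    rightNode-criterion : ∀ {a b} → 0 < a → a ≤ b → b < length s →
      (∀ {k y} → a < k → k ≤ b → b ≤ y → Lex ℓ (sub s a y) (sub s k y)) →
      (∀ {y} → b < y → Lex ℓ (sub s (suc b) y) (sub s a y)) →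
      RightNode ℓ s a b
    rightNode-criterion {a} {b} 0<a a≤b b<∣s∣ beats-later-starts beaten-by-next-start =
      descend (length s) root 0<a (<⇒≤pred b<∣s∣) (m∸n≤m (length s) 1)
      where
      descend : ∀ fuel {x y} → Node ℓ s x y → x < a → b ≤ y → y ≤ x + fuel → RightNode ℓ s a b
      descend zero {x} _ x<a b≤y y≤x+0 =
        ⊥-elim (<-irrefl (sym (+-identityʳ x)) (<-≤-trans x<a (≤-trans a≤b (≤-trans b≤y y≤x+0))))
      descend (suc fuel) {x} {y} node x<a b≤y y≤x+1+fuel
        with stdFact-exists (<-≤-trans x<a (≤-trans a≤b b≤y))
      ... | k , fact@(x<k , k≤y , _) with <-cmp k a
      ... | tri< k<a _ _ = descend fuel (right node fact) k<a b≤y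
            (≤-trans y≤x+1+fuel (≤-trans (≤-reflexive (+-suc x fuel)) (+-monoˡ-≤ fuel x<k)))
      ... | tri≈ _ refl _ with m≤n⇒m<n∨m≡n b≤y
      ...   | inj₁ b<y  = ⊥-elim (stdFact-minimal fact (<-trans x<a (s≤s a≤b)) b<y (beaten-by-next-start b<y))
      ...   | inj₂ refl = x , node , fact
      descend (suc fuel) {x} {y} node x<a b≤y y≤x+1+fuel | k , fact@(_ , k≤y , _) | tri> _ _ a<k with k ≤? b
      ... | yes k≤b = ⊥-elim (stdFact-minimal fact x<a (≤-trans a≤b b≤y) (beats-later-starts a<k k≤b b≤y))
      ... | no k≰b  = descend fuel (left node fact) x<a (<⇒≤pred (≰⇒> k≰b))
            (∸-monoˡ-≤ 1 (≤-trans k≤y (≤-trans y≤x+1+fuel (≤-reflexive (+-suc x fuel)))))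

    Lyndon⇒Lex-later-start : ∀ {a b k y} → Lyndon ℓ (sub s a b) → b < length s →
      a < k → k ≤ b → b ≤ y → Lex ℓ (sub s a y) (sub s k y)
    Lyndon⇒Lex-later-start {a} {b} {_} {y} (_ , lyndon) b<∣s∣ a<k k≤b b≤y with m≤n⇒∃[o]m+o≡n (<⇒≤ a<k)
    ... | t , refl = fromMismatch (Lex-toMismatch (lyndon t 0<t t<∣w∣) (subst (_≤ length w) (sym (length-drop t w)) (m∸n≤m _ t)))
      where
      w : List (Ext m)
      w = sub s a b
      0<t : 0 < t
      0<t = +-cancelˡ-< a 0 t (subst (_< a + t) (sym (+-identityʳ a)) a<k)
      t<∣w∣ : t < length w
      t<∣w∣ = subst (t <_) (sym (length-sub s a b<∣s∣)) (m+n≤o⇒n<1+o∸m a k≤b)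
      fromMismatch : ∃ (Mismatch ℓ (at w) (at (drop t w))) → Lex ℓ (sub s a y) (sub s (a + t) y)
      fromMismatch (q , mismatch@(_ , _ , _ , _ , w[t+q] , _)) =
        sub-Lex-mismatch a (a + t) q (≤-trans (+-monoʳ-≤ a (m≤n+m q t)) (≤-trans a+[t+q]≤b b≤y))
          (≤-trans (≤-reflexive (+-assoc a t q)) (≤-trans a+[t+q]≤b b≤y))
          (Mismatch-cong
            (λ r r≤q → at-sub s a (≤-trans (+-monoʳ-≤ a (m≤n+m r t)) (within r≤q)))
            (λ r r≤q → trans (at-drop t w r) (trans (at-sub s a (within r≤q)) (cong (at s) (sym (+-assoc a t r)))))
            mismatch)
        where
        a+[t+q]≤b : a + (t + q) ≤ b
        a+[t+q]≤b = n<1+o∸m⇒m+n≤o a (subst (t + q <_) (length-sub s a b<∣s∣)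
                      (at-just⇒< w (t + q) (trans (sym (at-drop t w q)) w[t+q])))
        within : ∀ {r} → r ≤ q → a + (t + r) ≤ b
        within r≤q = ≤-trans (+-monoʳ-≤ a (+-monoʳ-≤ t r≤q)) a+[t+q]≤b

    Period-sub⇒at : ∀ {i j p u} → Period (sub s i j) p → j < length s → i ≤ u → u + p ≤ j → at s (u + p) ≡ at s u
    Period-sub⇒at {i} {j} {p} (_ , period) j<∣s∣ i≤u u+p≤j with m≤n⇒∃[o]m+o≡n i≤u
    ... | g , refl = begin
      at s (i + g + p)          ≡⟨ cong (at s) (+-assoc i g p) ⟩
      at s (i + (g + p))        ≡⟨ sym (at-sub s i i+[g+p]≤j) ⟩
      at (sub s i j) (g + p)    ≡⟨ sym (period g (subst (g + p <_) (sym (length-sub s i j<∣s∣)) (m+n≤o⇒n<1+o∸m i i+[g+p]≤j))) ⟩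
      at (sub s i j) g          ≡⟨ at-sub s i (m+n≤o⇒m≤o (i + g) u+p≤j) ⟩
      at s (i + g)              ∎
      where
      open ≡-Reasoning
      i+[g+p]≤j : i + (g + p) ≤ j
      i+[g+p]≤j = subst (_≤ j) (+-assoc i g p) u+p≤j

    periodic⇒Lex-next-start : ∀ {i j p a b} → Period (sub s i j) p → j < length s →
      JustLt ℓ (at s (suc j)) (at s (suc j ∸ p)) → i ≤ a → a ≤ b → a + p ≡ suc b → b ≤ j →
      ∀ {y} → b < y → Lex ℓ (sub s (suc b) y) (sub s a y)
    periodic⇒Lex-next-start {i} {j} {p} {a} {b} period j<∣s∣ s[1+j]<s[1+j-p] i≤a a≤b a+p≡1+b b≤j {y} b<y =
      byCases (y ≤? j)
      where
      a+r+p≡1+b+r : ∀ r → a + r + p ≡ suc b + r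
      a+r+p≡1+b+r r = begin
        a + r + p   ≡⟨ +-assoc a r p ⟩
        a + (r + p) ≡⟨ cong (a +_) (+-comm r p) ⟩
        a + (p + r) ≡⟨ sym (+-assoc a p r) ⟩
        a + p + r   ≡⟨ cong (_+ r) a+p≡1+b ⟩
        suc b + r   ∎
        where open ≡-Reasoning
      shifted : ∀ {r} → suc b + r ≤ j → at s (suc b + r) ≡ at s (a + r)
      shifted {r} 1+b+r≤j = trans (cong (at s) (sym (a+r+p≡1+b+r r)))
        (Period-sub⇒at period j<∣s∣ (≤-trans i≤a (m≤m+n a r)) (subst (_≤ j) (sym (a+r+p≡1+b+r r)) 1+b+r≤j))
      byCases : Dec (y ≤ j) → Lex ℓ (sub s (suc b) y) (sub s a y)
      byCases (yes y≤j) = sub-Lex-prefix (s≤s a≤b) b<y (≤-<-trans y≤j j<∣s∣) (λ r 1+b+r≤y → shifted (≤-trans 1+b+r≤y y≤j))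
      byCases (no y≰j) = sub-Lex-mismatch (suc b) a q (≤-trans (≤-reflexive 1+b+q≡1+j) (≰⇒> y≰j))
        (≤-trans (+-monoˡ-≤ q (m≤n⇒m≤1+n a≤b)) (≤-trans (≤-reflexive 1+b+q≡1+j) (≰⇒> y≰j)))
        ((λ r r<q → shifted (≤-trans (+-monoʳ-< b r<q) (≤-reflexive b+q≡j))) ,
         subst₂ (λ u v → JustLt ℓ (at s u) (at s v)) (sym 1+b+q≡1+j) (sym a+q≡1+j∸p) s[1+j]<s[1+j-p])
        where
        q : ℕ
        q = j ∸ b
        b+q≡j : b + q ≡ j
        b+q≡j = m+[n∸m]≡n b≤j
        1+b+q≡1+j : suc b + q ≡ suc j
        1+b+q≡1+j = cong suc b+q≡j
        a+q≡1+j∸p : a + q ≡ suc j ∸ p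
        a+q≡1+j∸p = trans (sym (m+n∸n≡m (a + q) p)) (cong (_∸ p) (trans (a+r+p≡1+b+r q) 1+b+q≡1+j))

module _ {m : ℕ} (w : List (Fin m)) where

  ∣w∣<∣wℓ∣ : length w < length (wℓ w)
  ∣w∣<∣wℓ∣ = s≤s (subst (_≤ length (map ch w ++ dollar ∷ [])) (length-map ch w) (length-++-≤ˡ (map ch w)))

  map-wSub : ∀ {u v} → 1 ≤ u → v ≤ length w → map ch (wSub w u v) ≡ sub (wℓ w) u v
  map-wSub {suc u} {v} _ v≤∣w∣ = begin
    map ch (take (v ∸ u) (drop u w))                   ≡⟨ sym (take-map (v ∸ u) (drop u w)) ⟩
    take (v ∸ u) (map ch (drop u w))                   ≡⟨ cong (take (v ∸ u)) (sym (drop-map u w)) ⟩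
    take (v ∸ u) (drop u (map ch w))                   ≡⟨ sym (take-drop-++ˡ u (v ∸ u) (map ch w) _ v∸u≤) ⟩
    take (v ∸ u) (drop u (map ch w ++ dollar ∷ []))    ∎
    where
    open ≡-Reasoning
    v∸u≤ : v ∸ u ≤ length (map ch w) ∸ u
    v∸u≤ = subst (λ n → v ∸ u ≤ n ∸ u) (sym (length-map ch w)) (∸-monoˡ-≤ u v≤∣w∣)

lemma10 : (m : ℕ) → 2 ≤ m → (_≺_ : Rel (Fin m) 0ℓ) → IsStrictTotalOrder _≡_ _≺_ →
    (w : List (Fin m)) → (i j p : ℕ) → IsRun w i j p →
    (ℓ : Fin 2) → Ord.LtAt _≺_ ℓ w (suc j) (suc j ∸ p) →
    (a b : ℕ) → Ord.LRoot _≺_ ℓ w i j p a b → Ord.RightNodeOfLTree _≺_ ℓ w a b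
lemma10 _ _ _≺_ ≺-sto w i j p (1≤i , _ , j≤∣w∣ , (period , _) , _) ℓ w[1+j]<w[1+j-p]
        a b (1+b∸a≡p , i≤a , a≤b , b≤j , lyndon) =
  rightNode-criterion (wℓ w) 1≤a a≤b b<∣wℓ∣
    (Lyndon⇒Lex-later-start (wℓ w) (subst (Ord.Lyndon _≺_ ℓ) (map-wSub w 1≤a b≤∣w∣) lyndon) b<∣wℓ∣)
    (periodic⇒Lex-next-start (wℓ w) (subst (λ u → Period u p) (map-wSub w 1≤i j≤∣w∣) (Period-map ch {wSub w i j} period))
      (≤-<-trans j≤∣w∣ (∣w∣<∣wℓ∣ w)) w[1+j]<w[1+j-p] i≤a a≤b a+p≡1+b b≤j)
  where
  open LyndonTree ≺-sto
  1≤a : 1 ≤ a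
  1≤a = ≤-trans 1≤i i≤a
  b≤∣w∣ : b ≤ length w
  b≤∣w∣ = ≤-trans b≤j j≤∣w∣
  b<∣wℓ∣ : b < length (wℓ w)
  b<∣wℓ∣ = ≤-<-trans b≤∣w∣ (∣w∣<∣wℓ∣ w)
  a+p≡1+b : a + p ≡ suc b
  a+p≡1+b = trans (cong (a +_) (sym 1+b∸a≡p)) (m+[n∸m]≡n (m≤n⇒m≤1+n a≤b))
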